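{- For every positive integer $n \equiv 2 \pmod{7}$, there is no binary LCD $[n,3,\lfloor 4n/7 \rfloor]$ code.
   Context: All codes are binary linear codes; an $[n,k,d]$ code is a $k$-dimensional subspace of $\mathbb{F}_2^n$ with minimum nonzero Hamming weight $d$. A code $C$ is LCD if $C \cap C^\perp = \{\mathbf{0}_n\}$, where $C^\perp$ is the dual with respect to the standard inner product. -}

module Defs where

open import Data.Bool using (Bool; true; false; _xor_; _∧_)
open import Data.Nat using (ℕ; zero; suc; _+_; _≤_)
open import Data.Vec using (Vec; []; _∷_; replicate; zipWith; foldr)
open import Data.Product using (Σ; ∃; _×_)
open import Relation.Binary.PropositionalEquality using (_≡_)
open import Relation.Nullary using (¬_)

-- binary words of length n: elements of F₂ⁿ (Bool with xor as addition, ∧ as product)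
Word : ℕ → Set
Word n = Vec Bool n

zeroWord : (n : ℕ) → Word n
zeroWord n = replicate n false

_⊕_ : {n : ℕ} → Word n → Word n → Word n
_⊕_ = zipWith _xor_

weight : {n : ℕ} → Word n → ℕ
weight [] = 0
weight (true ∷ xs) = suc (weight xs)
weight (false ∷ xs) = weight xs

dot : {n : ℕ} → Word n → Word n → Bool
dot [] [] = false
dot (x ∷ xs) (y ∷ ys) = (x ∧ y) xor dot xs ys

GenMatrix : ℕ → ℕ → Set
GenMatrix k n = Vec (Word n) k

combine : {k n : ℕ} → Vec Bool k → GenMatrix k n → Word n
combine {n = n} [] [] = zeroWord n
combine (true ∷ cs) (g ∷ gs) = g ⊕ combine cs gs
combine (false ∷ cs) (g ∷ gs) = combine cs gs

_∈C_ : {k n : ℕ} → Word n → GenMatrix k n → Set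
x ∈C G = ∃ λ c → combine c G ≡ x

-- rows are linearly independent, so the span has dimension exactly k
LinIndep : {k n : ℕ} → GenMatrix k n → Set
LinIndep {k} G = ∀ c → combine c G ≡ zeroWord _ → c ≡ replicate k false

MinDist : {k n : ℕ} → GenMatrix k n → ℕ → Set
MinDist {n = n} G d =
  (∃ λ x → x ∈C G × ¬ (x ≡ zeroWord n) × weight x ≡ d)
  × (∀ x → x ∈C G → ¬ (x ≡ zeroWord n) → d ≤ weight x)

-- C ∩ C⊥ = {0}
LCD : {k n : ℕ} → GenMatrix k n → Set
LCD {n = n} G = ∀ x → x ∈C G → (∀ y → y ∈C G → dot x y ≡ false) → x ≡ zeroWord n

record LCDCode (n k d : ℕ) : Set where
  field
    gen    : GenMatrix k n
    indep  : LinIndep gen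
    minD   : MinDist gen d
    lcd    : LCD gen

-- The seven nonzero codewords of a three-dimensional code are x, y, z, x ⊕ y,
-- x ⊕ z, y ⊕ z, x ⊕ y ⊕ z, and each coordinate is 1 in at most four of them, so their weights add up
-- to at most 4n. For any x and y, weight x + weight y + weight (x ⊕ y) is even, so when d is odd each
-- of the lines {x, y, x ⊕ y}, {x, z, x ⊕ z}, {y, z, y ⊕ z} weighs at least 3d + 1; adding them to the
-- remaining weights gives 4n ≥ 7d + 2. But n ≡ 2 (mod 7) makes d = ⌊4n/7⌋ odd with 4n = 7d + 1.
module Submission where

open import Defs
open import Data.Bool using (Bool; true; false; _xor_)
open import Data.Bool.Properties using (xor-identityʳ)
open import Data.Nat using (ℕ; suc; _+_; _*_; _%_; _/_; _<_; _≤_; z≤n)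
open import Data.Nat.Properties
open import Data.Nat.DivMod using (m≡m%n+[m/n]*n; /-congˡ; +-distrib-/-∣ˡ; m*n/n≡m)
open import Data.Nat.Divisibility using (_∣_; divides; ∣m+n∣m⇒∣n; ∣m⇒∣m*n; m∣m*n; n∣m*n; ∣1⇒≡1)
open import Data.Nat.Tactic.RingSolver using (solve-∀)
open import Data.Vec using ([]; _∷_; replicate)
open import Data.Vec.Properties using (zipWith-identityʳ)
open import Data.Product using (_,_; proj₂)
open import Relation.Nullary using (¬_)
open import Relation.Binary.PropositionalEquality
  using (_≡_; _≢_; refl; sym; trans; cong; subst; module ≡-Reasoning)

bit : Bool → ℕ
bit true  = 1
bit false = 0

weight-∷ : ∀ {n} b (xs : Word n) → weight (b ∷ xs) ≡ bit b + weight xs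
weight-∷ true  xs = refl
weight-∷ false xs = refl

⊕-identityʳ : ∀ {n} (x : Word n) → x ⊕ zeroWord n ≡ x
⊕-identityʳ = zipWith-identityʳ xor-identityʳ

overlapSize : ∀ {n} → Word n → Word n → ℕ
overlapSize []          []          = 0
overlapSize (true ∷ xs) (true ∷ ys) = suc (overlapSize xs ys)
overlapSize (_ ∷ xs)    (_ ∷ ys)    = overlapSize xs ys

weight-⊕ : ∀ {n} (x y : Word n) → weight (x ⊕ y) + 2 * overlapSize x y ≡ weight x + weight y
weight-⊕ [] [] = refl
weight-⊕ (true ∷ xs) (true ∷ ys) = begin
  weight (xs ⊕ ys) + 2 * suc (overlapSize xs ys) ≡⟨ +-2*-suc (weight (xs ⊕ ys)) _ ⟩
  2 + (weight (xs ⊕ ys) + 2 * overlapSize xs ys) ≡⟨ cong (2 +_) (weight-⊕ xs ys) ⟩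
  2 + (weight xs + weight ys)                    ≡⟨ cong suc (sym (+-suc _ _)) ⟩
  suc (weight xs) + suc (weight ys)              ∎
  where
  open ≡-Reasoning
  +-2*-suc : ∀ w o → w + 2 * suc o ≡ 2 + (w + 2 * o)
  +-2*-suc = solve-∀
weight-⊕ (true ∷ xs) (false ∷ ys) = cong suc (weight-⊕ xs ys)
weight-⊕ (false ∷ xs) (true ∷ ys) =
  trans (cong suc (weight-⊕ xs ys)) (sym (+-suc (weight xs) (weight ys)))
weight-⊕ (false ∷ xs) (false ∷ ys) = weight-⊕ xs ys

even-triangle-weight : ∀ {n} (x y : Word n) → 2 ∣ weight x + weight y + weight (x ⊕ y)
even-triangle-weight x y = divides (weight (x ⊕ y) + overlapSize x y) (begin
  weight x + weight y + weight (x ⊕ y)                 ≡⟨ cong (_+ weight (x ⊕ y)) (sym (weight-⊕ x y)) ⟩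
  weight (x ⊕ y) + 2 * overlapSize x y + weight (x ⊕ y) ≡⟨ regroup (weight (x ⊕ y)) (overlapSize x y) ⟩
  (weight (x ⊕ y) + overlapSize x y) * 2               ∎)
  where
  open ≡-Reasoning
  regroup : ∀ w o → w + 2 * o + w ≡ (w + o) * 2
  regroup = solve-∀

triangle-weight-odd-bound : ∀ {n d} (x y : Word n) → ¬ 2 ∣ d →
  d ≤ weight x → d ≤ weight y → d ≤ weight (x ⊕ y) → 3 * d < weight x + weight y + weight (x ⊕ y)
triangle-weight-odd-bound {d = d} x y 2∤d d≤x d≤y d≤x⊕y = ≤∧≢⇒< 3d≤sum 3d≢sum
  where
  3*≡2*+ : ∀ m → 3 * m ≡ 2 * m + m
  3*≡2*+ = solve-∀

  +-+≡3* : ∀ m → m + m + m ≡ 3 * m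
  +-+≡3* = solve-∀

  3d≤sum : 3 * d ≤ weight x + weight y + weight (x ⊕ y)
  3d≤sum = subst (_≤ weight x + weight y + weight (x ⊕ y)) (+-+≡3* d)
             (+-mono-≤ (+-mono-≤ d≤x d≤y) d≤x⊕y)

  3d≢sum : 3 * d ≢ weight x + weight y + weight (x ⊕ y)
  3d≢sum 3d≡sum = 2∤d (∣m+n∣m⇒∣n 2∣2d+d (m∣m*n d))
    where
    2∣2d+d : 2 ∣ 2 * d + d
    2∣2d+d = subst (2 ∣_) (trans (sym 3d≡sum) (3*≡2*+ d)) (even-triangle-weight x y)

spanSum : {A : Set} → (A → A → A) → (A → ℕ) → A → A → A → ℕ
spanSum _∙_ f x y z =
  f x + f y + f z + f (x ∙ y) + f (x ∙ z) + f (y ∙ z) + f (x ∙ (y ∙ z))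

spanWeight : ∀ {n} → Word n → Word n → Word n → ℕ
spanWeight = spanSum _⊕_ weight

spanBits : Bool → Bool → Bool → ℕ
spanBits = spanSum _xor_ bit

spanBits≤4 : ∀ a b c → spanBits a b c ≤ 4
spanBits≤4 true  true  true  = ≤-refl
spanBits≤4 true  true  false = ≤-refl
spanBits≤4 true  false true  = ≤-refl
spanBits≤4 true  false false = ≤-refl
spanBits≤4 false true  true  = ≤-refl
spanBits≤4 false true  false = ≤-refl
spanBits≤4 false false true  = ≤-refl
spanBits≤4 false false false = z≤n

spanWeight-∷ : ∀ {n} a b c (xs ys zs : Word n) →
  spanWeight (a ∷ xs) (b ∷ ys) (c ∷ zs) ≡ spanBits a b c + spanWeight xs ys zs
spanWeight-∷ a b c xs ys zs
  rewrite weight-∷ a xs | weight-∷ b ys | weight-∷ c zs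
        | weight-∷ (a xor b) (xs ⊕ ys) | weight-∷ (a xor c) (xs ⊕ zs) | weight-∷ (b xor c) (ys ⊕ zs)
        | weight-∷ (a xor (b xor c)) (xs ⊕ (ys ⊕ zs)) =
    interchange (bit a) (bit b) (bit c) (bit (a xor b)) (bit (a xor c)) (bit (b xor c)) (bit (a xor (b xor c)))
      (weight xs) (weight ys) (weight zs) (weight (xs ⊕ ys)) (weight (xs ⊕ zs)) (weight (ys ⊕ zs))
      (weight (xs ⊕ (ys ⊕ zs)))
  where
  interchange : ∀ a₁ a₂ a₃ a₄ a₅ a₆ a₇ w₁ w₂ w₃ w₄ w₅ w₆ w₇ →
    (a₁ + w₁) + (a₂ + w₂) + (a₃ + w₃) + (a₄ + w₄) + (a₅ + w₅) + (a₆ + w₆) + (a₇ + w₇)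
    ≡ (a₁ + a₂ + a₃ + a₄ + a₅ + a₆ + a₇) + (w₁ + w₂ + w₃ + w₄ + w₅ + w₆ + w₇)
  interchange = solve-∀

spanWeight≤4n : ∀ {n} (x y z : Word n) → spanWeight x y z ≤ 4 * n
spanWeight≤4n [] [] [] = z≤n
spanWeight≤4n {suc n} (a ∷ xs) (b ∷ ys) (c ∷ zs) = begin
  spanWeight (a ∷ xs) (b ∷ ys) (c ∷ zs) ≡⟨ spanWeight-∷ a b c xs ys zs ⟩
  spanBits a b c + spanWeight xs ys zs  ≤⟨ +-mono-≤ (spanBits≤4 a b c) (spanWeight≤4n xs ys zs) ⟩
  4 + 4 * n                             ≡⟨ sym (*-suc 4 n) ⟩
  4 * suc n                             ∎
  where open ≤-Reasoning

-- The three line sums together with x + y + z + 2t count each of the seven weights twice.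
three-lines-bound : ∀ d {a b c x y z t} → d ≤ x → d ≤ y → d ≤ z → d ≤ t →
  3 * d < a + b + x → 3 * d < a + c + y → 3 * d < b + c + z →
  7 * d + 1 < a + b + c + x + y + z + t
three-lines-bound d {a} {b} {c} {x} {y} {z} {t} d≤x d≤y d≤z d≤t xy xz yz =
  *-cancelˡ-< 2 (7 * d + 1) (a + b + c + x + y + z + t) (begin-strict
    2 * (7 * d + 1)                                                <⟨ n<1+n _ ⟩
    suc (2 * (7 * d + 1))                                          ≡⟨ split d ⟩
    suc (3 * d) + suc (3 * d) + suc (3 * d) + (d + d + d + d + d)  ≤⟨ +-mono-≤ (+-mono-≤ (+-mono-≤ xy xz) yz) rest ⟩
    (a + b + x) + (a + c + y) + (b + c + z) + (x + y + z + t + t)  ≡⟨ regroup a b c x y z t ⟩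
    2 * (a + b + c + x + y + z + t)                                ∎)
  where
  open ≤-Reasoning
  rest : d + d + d + d + d ≤ x + y + z + t + t
  rest = +-mono-≤ (+-mono-≤ (+-mono-≤ (+-mono-≤ d≤x d≤y) d≤z) d≤t) d≤t
  split : ∀ d → suc (2 * (7 * d + 1)) ≡ suc (3 * d) + suc (3 * d) + suc (3 * d) + (d + d + d + d + d)
  split = solve-∀
  regroup : ∀ a b c x y z t →
    (a + b + x) + (a + c + y) + (b + c + z) + (x + y + z + t + t) ≡ 2 * (a + b + c + x + y + z + t)
  regroup = solve-∀

nonzero-codeword-weight : ∀ {k n d} {G : GenMatrix k n} → LinIndep G → MinDist G d →
  ∀ c → ¬ c ≡ replicate k false → d ≤ weight (combine c G)
nonzero-codeword-weight {G = G} indep minD c c≢0 =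
  proj₂ minD (combine c G) (c , refl) (λ c↦0 → c≢0 (indep c c↦0))

odd-distance-bound : ∀ {n d} (G : GenMatrix 3 n) → LinIndep G → MinDist G d → ¬ 2 ∣ d →
  7 * d + 1 < 4 * n
odd-distance-bound {d = d} G@(g₁ ∷ g₂ ∷ g₃ ∷ []) indep minD 2∤d =
  <-≤-trans
    (three-lines-bound d {weight g₁} {weight g₂} {weight g₃} d≤g₁₂ d≤g₁₃ d≤g₂₃ d≤g₁₂₃
      (line g₁ g₂ d≤g₁ d≤g₂ d≤g₁₂) (line g₁ g₃ d≤g₁ d≤g₃ d≤g₁₃) (line g₂ g₃ d≤g₂ d≤g₃ d≤g₂₃))
    (spanWeight≤4n g₁ g₂ g₃)
  where
  line : ∀ x y → d ≤ weight x → d ≤ weight y → d ≤ weight (x ⊕ y) →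
    3 * d < weight x + weight y + weight (x ⊕ y)
  line x y = triangle-weight-odd-bound x y 2∤d

  d≤weight : ∀ c {x} → ¬ c ≡ replicate 3 false → combine c G ≡ x → d ≤ weight x
  d≤weight c c≢0 refl = nonzero-codeword-weight indep minD c c≢0

  d≤g₁ : d ≤ weight g₁
  d≤g₁ = d≤weight (true ∷ false ∷ false ∷ []) (λ ()) (⊕-identityʳ g₁)
  d≤g₂ : d ≤ weight g₂
  d≤g₂ = d≤weight (false ∷ true ∷ false ∷ []) (λ ()) (⊕-identityʳ g₂)
  d≤g₃ : d ≤ weight g₃
  d≤g₃ = d≤weight (false ∷ false ∷ true ∷ []) (λ ()) (⊕-identityʳ g₃)
  d≤g₁₂ : d ≤ weight (g₁ ⊕ g₂)
  d≤g₁₂ = d≤weight (true ∷ true ∷ false ∷ []) (λ ()) (cong (g₁ ⊕_) (⊕-identityʳ g₂))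
  d≤g₁₃ : d ≤ weight (g₁ ⊕ g₃)
  d≤g₁₃ = d≤weight (true ∷ false ∷ true ∷ []) (λ ()) (cong (g₁ ⊕_) (⊕-identityʳ g₃))
  d≤g₂₃ : d ≤ weight (g₂ ⊕ g₃)
  d≤g₂₃ = d≤weight (false ∷ true ∷ true ∷ []) (λ ()) (cong (g₂ ⊕_) (⊕-identityʳ g₃))
  d≤g₁₂₃ : d ≤ weight (g₁ ⊕ (g₂ ⊕ g₃))
  d≤g₁₂₃ = d≤weight (true ∷ true ∷ true ∷ []) (λ ()) (cong (λ w → g₁ ⊕ (g₂ ⊕ w)) (⊕-identityʳ g₃))

4n≡7d+1 : ∀ n → n % 7 ≡ 2 → 4 * n ≡ 7 * (4 * (n / 7) + 1) + 1
4n≡7d+1 n n%7≡2 = begin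
  4 * n                   ≡⟨ cong (4 *_) (m≡m%n+[m/n]*n n 7) ⟩
  4 * (n % 7 + n / 7 * 7) ≡⟨ cong (λ r → 4 * (r + n / 7 * 7)) n%7≡2 ⟩
  4 * (2 + n / 7 * 7)     ≡⟨ expand (n / 7) ⟩
  7 * (4 * (n / 7) + 1) + 1 ∎
  where
  open ≡-Reasoning
  expand : ∀ m → 4 * (2 + m * 7) ≡ 7 * (4 * m + 1) + 1
  expand = solve-∀

[7d+1]/7≡d : ∀ d → (7 * d + 1) / 7 ≡ d
[7d+1]/7≡d d = begin
  (7 * d + 1) / 7   ≡⟨ /-congˡ (cong (_+ 1) (*-comm 7 d)) ⟩
  (d * 7 + 1) / 7   ≡⟨ +-distrib-/-∣ˡ 1 (n∣m*n d) ⟩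
  d * 7 / 7 + 1 / 7 ≡⟨ +-identityʳ (d * 7 / 7) ⟩
  d * 7 / 7         ≡⟨ m*n/n≡m d 7 ⟩
  d                 ∎
  where open ≡-Reasoning

2∤4m+1 : ∀ m → ¬ 2 ∣ 4 * m + 1
2∤4m+1 m 2∣4m+1 with ∣1⇒≡1 (∣m+n∣m⇒∣n 2∣4m+1 (∣m⇒∣m*n m (divides 2 refl)))
... | ()

-- The hypothesis 0 < n is implied by n % 7 ≡ 2.
lemma5p2 : (n : ℕ) → 0 < n → n % 7 ≡ 2 → ¬ LCDCode n 3 ((4 * n) / 7)
lemma5p2 n _ n%7≡2 code = <-irrefl (sym (4n≡7d+1 n n%7≡2)) (odd-distance-bound gen indep minD′ 2∤d)
  where
  open LCDCode code
  d≡4m+1 : (4 * n) / 7 ≡ 4 * (n / 7) + 1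
  d≡4m+1 = trans (/-congˡ (4n≡7d+1 n n%7≡2)) ([7d+1]/7≡d (4 * (n / 7) + 1))

  minD′ : MinDist gen (4 * (n / 7) + 1)
  minD′ = subst (MinDist gen) d≡4m+1 minD

  2∤d : ¬ 2 ∣ 4 * (n / 7) + 1
  2∤d = 2∤4m+1 (n / 7)
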